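{- Let $\ell\ge 1$ be an integer and $T$ a finite tree with maximum degree at most $2\ell-2$ and at most one vertex of degree exactly $2\ell-2$. Then Breaker has a winning strategy in the $K_{1,\ell}$-game on $T$.
   Context: In a Maker-Breaker game on the edge set of a graph $G$, Maker and Breaker alternately claim previously unclaimed edges of $G$, Maker first, until all edges are claimed; Maker wins if she claims all edges of some winning set, and Breaker wins otherwise. In the $K_{1,\ell}$-game, the winning sets are the edge sets of subgraphs isomorphic to the star $K_{1,\ell}$ with $\ell$ edges; i.e. Maker wins if she claims $\ell$ edges incident to a common vertex. -}

module Defs where

open import Data.Nat using (ℕ; zero; suc; _+_; _*_; _∸_; _≤_; _<_)
open import Data.Fin using (Fin; toℕ)
open import Data.Fin.Properties using (_≟_)
open import Data.List using (List; []; _∷_; _++_; [_]; length; filter)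
open import Data.List.Membership.Propositional using (_∈_; _∉_)
open import Data.List.Relation.Unary.All using (All)
open import Data.List.Relation.Unary.Unique.Propositional using (Unique)
open import Data.Product using (Σ; ∃; ∃-syntax; _×_; _,_; proj₁; proj₂)
open import Data.Sum using (_⊎_)
open import Data.Unit using (⊤)
open import Relation.Nullary using (¬_)
open import Relation.Nullary.Decidable using (_⊎-dec_)
open import Relation.Binary.PropositionalEquality using (_≡_)

-- Finite simple graphs on vertex set Fin n.
-- An edge {u,v} is stored once, as the ordered pair (u , v) with u < v.

Edge : ℕ → Set
Edge n = Fin n × Fin n

record Graph (n : ℕ) : Set where
  field
    edges    : List (Edge n)
    ordered  : All (λ e → toℕ (proj₁ e) < toℕ (proj₂ e)) edges
    distinct : Unique edges

module _ {n : ℕ} (G : Graph n) where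
  open Graph G

  Adj : Fin n → Fin n → Set
  Adj u v = ((u , v) ∈ edges) ⊎ ((v , u) ∈ edges)

  Incident : Fin n → Edge n → Set
  Incident v e = (proj₁ e ≡ v) ⊎ (proj₂ e ≡ v)

  degree : Fin n → ℕ
  degree v = length (filter (λ e → (proj₁ e ≟ v) ⊎-dec (proj₂ e ≟ v)) edges)

  data Walk : Fin n → Fin n → Set where
    here : ∀ {v} → Walk v v
    step : ∀ {u w v} → Adj u w → Walk w v → Walk u v

  Connected : Set
  Connected = ∀ u v → Walk u v

  Chain : List (Fin n) → Set
  Chain []           = ⊤
  Chain (_ ∷ [])     = ⊤
  Chain (u ∷ w ∷ vs) = Adj u w × Chain (w ∷ vs)

  HasCycle : Set
  HasCycle = Σ (Fin n) λ v → Σ (List (Fin n)) λ ws →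
               (2 ≤ length ws) × Unique (v ∷ ws) × Chain (v ∷ ws ++ [ v ])

  Acyclic : Set
  Acyclic = ¬ HasCycle

  IsTree : Set
  IsTree = Connected × Acyclic

-- Maker–Breaker games on a finite board (list of elements), Maker first,
-- played until every element is claimed.  BreakerWinsM M B / BreakerWinsB M B: Breaker has a
-- winning strategy from the position where Maker has claimed M, Breaker
-- has claimed B, and it is Maker's / Breaker's turn (inductive game tree,
-- i.e. a winning strategy for Breaker against every Maker strategy).

module _ {X : Set} (board : List X) (MakerWin : List X → Set) where

  AllClaimed : List X → List X → Set
  AllClaimed M B = ∀ e → e ∈ board → (e ∈ M) ⊎ (e ∈ B)

  Free : List X → List X → X → Set
  Free M B e = (e ∈ board) × (e ∉ M) × (e ∉ B)

  mutual
    data BreakerWinsM (M B : List X) : Set where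
      endM  : AllClaimed M B → ¬ MakerWin M → BreakerWinsM M B
      moveM : (∃[ e ] Free M B e) →
              (∀ e → Free M B e → BreakerWinsB (e ∷ M) B) →
              BreakerWinsM M B

    data BreakerWinsB (M B : List X) : Set where
      endB  : AllClaimed M B → ¬ MakerWin M → BreakerWinsB M B
      moveB : ∀ e → Free M B e → BreakerWinsM M (e ∷ B) → BreakerWinsB M B

  BreakerHasWinningStrategy : Set
  BreakerHasWinningStrategy = BreakerWinsM [] []

module _ {n : ℕ} (G : Graph n) where

  HasStar : ℕ → List (Edge n) → Set
  HasStar ℓ M = Σ (Fin n) λ v → Σ (List (Edge n)) λ S →
                  (length S ≡ ℓ) × Unique S × All (_∈ M) S × All (Incident G v) S

  BreakerWinsStarGame : ℕ → Set
  BreakerWinsStarGame ℓ = BreakerHasWinningStrategy (Graph.edges G) (HasStar ℓ)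

-- Breaker plays a pairing strategy. Root T at its vertex of degree 2ℓ − 2 (anywhere if there is
-- none; the rooting is obtained by repeatedly deleting a leaf other than the root) and call the
-- endpoint of an edge farther from the root its child. At every vertex v, list the edges from v
-- down to its children and pair them off consecutively; whenever Maker claims an edge, Breaker
-- claims its partner if it is free. In the end Maker holds, at each vertex v, at most one edge of
-- every pair plus possibly the edge from v up to its parent: at most ⌈(2ℓ − 2)/2⌉ = ℓ − 1 edges at
-- the root and, as every other vertex has degree at most 2ℓ − 3, at most 1 + ⌈(2ℓ − 4)/2⌉ = ℓ − 1
-- edges elsewhere.

module Submission where

open import Defs
open import Data.Nat using () renaming (_≟_ to _≟ℕ_)
open import Data.Nat
  using (ℕ; zero; suc; _+_; _*_; _∸_; _≤_; _<_; z≤n; s≤s; z<s; ⌊_/2⌋; ⌈_/2⌉; parity)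
open import Data.Nat.Properties
open import Data.Parity.Base using (Parity; 0ℙ; 1ℙ)
open import Data.Fin using (Fin; toℕ)
import Data.Fin.Properties as Fin
open import Data.List using (List; []; _∷_; _++_; [_]; length; filter; map)
open import Data.List.Properties
  using (filter-some; filter-notAll; filter-all; filter-none; ++-assoc; length-++; length-map)
open import Data.List.Membership.Propositional.Properties using (∈-filter⁺; ∈-filter⁻; ∈-∃++)
open import Data.List.Membership.Propositional using (_∈_; _∉_; find; lose)
import Data.List.Membership.DecPropositional as DecMembership
import Data.List.Membership.Setoid.Properties as SetoidMembership
open import Data.List.Relation.Unary.Any as Any using (Any; here; there; any?)
open import Data.List.Relation.Unary.All as All using (All; []; _∷_)
import Data.List.Relation.Unary.All.Properties as All
open import Data.List.Relation.Unary.AllPairs using ([]; _∷_)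
open import Data.List.Relation.Unary.Unique.Propositional using (Unique)
open import Data.List.Relation.Binary.Subset.Propositional using (_⊆_)
import Data.List.Relation.Unary.Unique.Propositional.Properties as Unique
open import Data.Product.Properties using (≡-dec)
open import Data.Product using (Σ-syntax; ∃; ∃-syntax; _×_; _,_; proj₁; proj₂)
open import Data.Sum using (_⊎_; inj₁; inj₂; map₁)
open import Data.Unit using (tt)
open import Function using (_∘_)
open import Level using (0ℓ)
open import Relation.Nullary using (¬_; Dec; yes; no; ¬?; contradiction)
open import Relation.Nullary.Decidable using (_×-dec_; _⊎-dec_)
open import Relation.Unary using (Pred; Decidable)
open import Relation.Binary.Definitions using (DecidableEquality)
open import Relation.Binary.PropositionalEquality
  using (_≡_; _≢_; refl; sym; trans; cong; subst; setoid)

module _ {X : Set} {P Q : Pred X 0ℓ} (P? : Decidable P) (Q? : Decidable Q) where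

  length-filter-mono : (∀ {x} → Q x → P x) → ∀ xs → length (filter Q? xs) ≤ length (filter P? xs)
  length-filter-mono Q⇒P [] = z≤n
  length-filter-mono Q⇒P (x ∷ xs) with P? x | Q? x
  ... | yes _  | yes _  = s≤s (length-filter-mono Q⇒P xs)
  ... | yes _  | no _   = m≤n⇒m≤1+n (length-filter-mono Q⇒P xs)
  ... | no ¬px | yes qx = contradiction (Q⇒P qx) ¬px
  ... | no _   | no _   = length-filter-mono Q⇒P xs

  length-filter-strict : (∀ {x} → Q x → P x) → ∀ {x} xs → x ∈ xs → P x → ¬ Q x →
                         length (filter Q? xs) < length (filter P? xs)
  length-filter-strict Q⇒P (x ∷ xs) (here refl) px ¬qx with P? x | Q? x
  ... | yes _  | yes qx = contradiction qx ¬qx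
  ... | yes _  | no _   = s≤s (length-filter-mono Q⇒P xs)
  ... | no ¬px | _      = contradiction px ¬px
  length-filter-strict Q⇒P (y ∷ xs) (there x∈xs) px ¬qx with P? y | Q? y
  ... | yes _  | yes _  = s≤s (length-filter-strict Q⇒P xs x∈xs px ¬qx)
  ... | yes _  | no _   = m≤n⇒m≤1+n (length-filter-strict Q⇒P xs x∈xs px ¬qx)
  ... | no ¬py | yes qy = contradiction (Q⇒P qy) ¬py
  ... | no _   | no _   = length-filter-strict Q⇒P xs x∈xs px ¬qx

  length-filter-split : (∀ {x} → P x → Q x) → ∀ xs →
    length (filter Q? xs) ≡ length (filter P? xs) + length (filter (λ x → Q? x ×-dec ¬? (P? x)) xs)
  length-filter-split P⇒Q [] = refl
  length-filter-split P⇒Q (x ∷ xs) with P? x | Q? x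
  ... | yes _  | yes _  = cong suc (length-filter-split P⇒Q xs)
  ... | yes px | no ¬qx = contradiction (P⇒Q px) ¬qx
  ... | no _   | yes _  = trans (cong suc (length-filter-split P⇒Q xs)) (sym (+-suc _ _))
  ... | no _   | no _   = length-filter-split P⇒Q xs

module _ {X : Set} {P : Pred X 0ℓ} (P? : Decidable P) where

  length-filter≤1 : ∀ {xs} → Unique xs →
                    (∀ {a b} → a ∈ xs → b ∈ xs → P a → P b → a ≡ b) →
                    length (filter P? xs) ≤ 1
  length-filter≤1 {[]} [] _ = z≤n
  length-filter≤1 {x ∷ xs} (x∉xs ∷ unique) P-unique with P? x
  ... | yes px = s≤s (≤-reflexive (cong length (filter-none P? (All.tabulate
          λ y∈xs py → All.lookup x∉xs y∈xs (sym (P-unique (there y∈xs) (here refl) py px))))))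
  ... | no _   = length-filter≤1 unique (λ a∈ b∈ → P-unique (there a∈) (there b∈))

  filter-nonempty : ∀ xs → 0 < length (filter P? xs) → Any P xs
  filter-nonempty (x ∷ xs) pos with P? x
  ... | yes px = here px
  ... | no _   = there (filter-nonempty xs pos)

length≤1+length-filter-≢ : ∀ {X : Set} (_≟_ : DecidableEquality X) a {xs} → Unique xs →
                           length xs ≤ suc (length (filter (¬? ∘ (_≟ a)) xs))
length≤1+length-filter-≢ _≟_ a {[]}     []               = z≤n
length≤1+length-filter-≢ _≟_ a {x ∷ xs} (x∉xs ∷ unique) with x ≟ a
... | yes refl = s≤s (≤-reflexive (sym (cong length (filter-all (¬? ∘ (_≟ a))
                   (All.map (λ x≢y y≡x → x≢y (sym y≡x)) x∉xs)))))
... | no _     = s≤s (length≤1+length-filter-≢ _≟_ a unique)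

Unique-<⇒length≤ : ∀ k {xs} → Unique xs → All (_< k) xs → length xs ≤ k
Unique-<⇒length≤ zero {[]} _ _ = z≤n
Unique-<⇒length≤ zero {_ ∷ _} _ (() ∷ _)
Unique-<⇒length≤ (suc k) {xs} unique bounded =
  ≤-trans (length≤1+length-filter-≢ _≟_ k unique)
          (s≤s (Unique-<⇒length≤ k (Unique.filter⁺ ≢k? unique)
                  (All.zipWith (λ (x<1+k , x≢k) → ≤∧≢⇒< (≤-pred x<1+k) x≢k)
                     (All.filter⁺ ≢k? bounded , All.all-filter ≢k? xs))))
  where
  ≢k? : Decidable (_≢ k)
  ≢k? = ¬? ∘ (_≟ k)

Unique-Fin⇒length≤ : ∀ {n} {xs : List (Fin n)} → Unique xs → length xs ≤ n
Unique-Fin⇒length≤ {n} {xs} unique = subst (_≤ n) (length-map toℕ xs)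
  (Unique-<⇒length≤ n (Unique.map⁺ Fin.toℕ-injective unique)
                      (All.map⁺ (All.tabulate (λ {x} _ → Fin.toℕ<n x))))

Unique-map⁺-on : ∀ {X Y : Set} {P : Pred X 0ℓ} (f : X → Y) →
                 (∀ {a b} → P a → P b → a ≢ b → f a ≢ f b) →
                 ∀ {xs} → All P xs → Unique xs → Unique (map f xs)
Unique-map⁺-on f f-inj {[]} [] [] = []
Unique-map⁺-on f f-inj {x ∷ xs} (px ∷ pxs) (x∉xs ∷ unique) =
  All.map⁺ (All.zipWith (λ (py , x≢y) → f-inj px py x≢y) (pxs , x∉xs))
  ∷ Unique-map⁺-on f f-inj pxs unique

Unique-++⁻ˡ : ∀ {X : Set} (xs : List X) {ys} → Unique (xs ++ ys) → Unique xs
Unique-++⁻ˡ []       _                  = []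
Unique-++⁻ˡ (x ∷ xs) (x∉xs++ys ∷ unique) = All.++⁻ˡ xs x∉xs++ys ∷ Unique-++⁻ˡ xs unique

empty-or-member : ∀ {A : Set} (xs : List A) → (∀ {x} → x ∉ xs) ⊎ ∃ (_∈ xs)
empty-or-member []      = inj₁ λ ()
empty-or-member (x ∷ _) = inj₂ (x , here refl)

parity-binary : ∀ {p q r : Parity} → p ≢ q → p ≢ r → q ≡ r
parity-binary {0ℙ} {0ℙ} p≢q _   = contradiction refl p≢q
parity-binary {1ℙ} {1ℙ} p≢q _   = contradiction refl p≢q
parity-binary {0ℙ} {1ℙ} {0ℙ} _ p≢r = contradiction refl p≢r
parity-binary {1ℙ} {0ℙ} {1ℙ} _ p≢r = contradiction refl p≢r
parity-binary {0ℙ} {1ℙ} {1ℙ} _ _ = refl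
parity-binary {1ℙ} {0ℙ} {0ℙ} _ _ = refl

⌊/2⌋-parity-injective : ∀ {i j} → ⌊ i /2⌋ ≡ ⌊ j /2⌋ → parity i ≡ parity j → i ≡ j
⌊/2⌋-parity-injective {zero}        {zero}        _ _  = refl
⌊/2⌋-parity-injective {suc zero}    {suc zero}    _ _  = refl
⌊/2⌋-parity-injective {zero}        {suc zero}    _ ()
⌊/2⌋-parity-injective {suc zero}    {zero}        _ ()
⌊/2⌋-parity-injective {suc (suc i)} {suc (suc j)} h p =
  cong (suc ∘ suc) (⌊/2⌋-parity-injective (suc-injective h) p)

⌊/2⌋-fibre : ∀ {i j k} → ⌊ i /2⌋ ≡ ⌊ j /2⌋ → ⌊ i /2⌋ ≡ ⌊ k /2⌋ →
             i ≢ j → i ≢ k → j ≡ k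
⌊/2⌋-fibre i~j i~k i≢j i≢k = ⌊/2⌋-parity-injective (trans (sym i~j) i~k)
  (parity-binary (i≢j ∘ ⌊/2⌋-parity-injective i~j) (i≢k ∘ ⌊/2⌋-parity-injective i~k))

⌊/2⌋-< : ∀ {k m} → k < 2 * m → ⌊ k /2⌋ < m
⌊/2⌋-< {k} {m} k<2m = *-cancelˡ-< 2 _ _ (≤-<-trans twice⌊k/2⌋≤k k<2m)
  where
  open ≤-Reasoning
  twice⌊k/2⌋≤k : 2 * ⌊ k /2⌋ ≤ k
  twice⌊k/2⌋≤k = begin
    2 * ⌊ k /2⌋           ≡⟨ cong (⌊ k /2⌋ +_) (+-identityʳ _) ⟩
    ⌊ k /2⌋ + ⌊ k /2⌋     ≤⟨ +-monoʳ-≤ ⌊ k /2⌋ (⌊n/2⌋≤⌈n/2⌉ k) ⟩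
    ⌊ k /2⌋ + ⌈ k /2⌉     ≡⟨ ⌊n/2⌋+⌈n/2⌉≡n k ⟩
    k                     ∎

module Positions {X : Set} (_≟_ : DecidableEquality X) where

  open DecMembership _≟_ using (_∈?_)

  position : List X → X → ℕ
  position xs x with x ∈? xs
  ... | yes x∈xs = toℕ (Any.index x∈xs)
  ... | no _     = 0  -- junk value, never used for x ∉ xs

  position< : ∀ {x xs} → x ∈ xs → position xs x < length xs
  position< {x} {xs} x∈xs with x ∈? xs
  ... | yes x∈xs′ = Fin.toℕ<n (Any.index x∈xs′)
  ... | no x∉xs   = contradiction x∈xs x∉xs

  position-injective : ∀ {x y xs} → x ∈ xs → y ∈ xs → position xs x ≡ position xs y → x ≡ y
  position-injective {x} {y} {xs} x∈xs y∈xs eq with x ∈? xs | y ∈? xs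
  ... | yes x∈xs′ | yes y∈xs′ =
    SetoidMembership.index-injective (setoid X) x∈xs′ y∈xs′ (Fin.toℕ-injective eq)
  ... | no x∉xs   | _         = contradiction x∈xs x∉xs
  ... | _         | no y∉xs   = contradiction y∈xs y∉xs

  PairedIn : List X → X → X → Set
  PairedIn xs a b = a ∈ xs × b ∈ xs × a ≢ b × ⌊ position xs a /2⌋ ≡ ⌊ position xs b /2⌋

  PairedIn? : ∀ xs a b → Dec (PairedIn xs a b)
  PairedIn? xs a b =
    a ∈? xs ×-dec b ∈? xs ×-dec ¬? (a ≟ b)
    ×-dec (⌊ position xs a /2⌋ ≟ℕ ⌊ position xs b /2⌋)

  PairedIn-sym : ∀ {xs a b} → PairedIn xs a b → PairedIn xs b a
  PairedIn-sym (a∈ , b∈ , a≢b , a~b) = b∈ , a∈ , a≢b ∘ sym , sym a~b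

  PairedIn-functional : ∀ {xs a b c} → PairedIn xs a b → PairedIn xs a c → b ≡ c
  PairedIn-functional (a∈ , b∈ , a≢b , a~b) (_ , c∈ , a≢c , a~c) =
    position-injective b∈ c∈ (⌊/2⌋-fibre a~b a~c
      (a≢b ∘ position-injective a∈ b∈) (a≢c ∘ position-injective a∈ c∈))

module PairingStrategy {X : Set} (_≟_ : DecidableEquality X) (board : List X)
                       (MakerWin : List X → Set) where

  open DecMembership _≟_ using (_∈?_)

  record Pairing : Set₁ where
    field
      Paired            : X → X → Set
      Paired?           : ∀ a b → Dec (Paired a b)
      Paired-sym        : ∀ {a b} → Paired a b → Paired b a
      Paired-functional : ∀ {a b c} → Paired a b → Paired a c → b ≡ c
      Paired-irrefl     : ∀ {a} → ¬ Paired a a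
      partner∈board     : ∀ {a b} → Paired a b → b ∈ board

  PairFree : Pairing → List X → Set
  PairFree pairing M = ∀ {a b} → Paired a b → a ∈ M → b ∉ M
    where open Pairing pairing

  module Strategy (pairing : Pairing)
                  (pairFree⇒¬win : ∀ {M} → M ⊆ board → PairFree pairing M → ¬ MakerWin M) where

    open Pairing pairing

    record Invariant (M B : List X) : Set where
      field
        on-board : ∀ {x} → x ∈ M → x ∈ board
        disjoint : ∀ {x} → x ∈ M → x ∉ B
        answered : ∀ {a b} → Paired a b → a ∈ M → b ∈ B

    initial : Invariant [] []
    initial = record { on-board = λ () ; disjoint = λ () ; answered = λ _ () }

    pairFree : ∀ {M B} → Invariant M B → PairFree pairing M
    pairFree inv a~b a∈M b∈M = Invariant.disjoint inv b∈M (Invariant.answered inv a~b a∈M)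

    claimByMaker : ∀ {M B e} → Invariant M B → Free board MakerWin M B e →
                   (∀ {c} → Paired e c → c ∈ B) → Invariant (e ∷ M) B
    claimByMaker {e = e} inv (e∈board , _ , e∉B) partners∈B = record
      { on-board = λ { (here refl) → e∈board ; (there x∈M) → on-board x∈M }
      ; disjoint = λ { (here refl) → e∉B ; (there x∈M) → disjoint x∈M }
      ; answered = λ { a~b (here refl) → partners∈B a~b ; a~b (there a∈M) → answered a~b a∈M }
      }
      where open Invariant inv

    claimByBreaker : ∀ {M B f} → Invariant M B → f ∉ M → Invariant M (f ∷ B)
    claimByBreaker inv f∉M = record
      { on-board = on-board
      ; disjoint = λ { x∈M (here refl) → f∉M x∈M ; x∈M (there x∈B) → disjoint x∈M x∈B }
      ; answered = λ a~b a∈M → there (answered a~b a∈M)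
      }
      where open Invariant inv

    free? : ∀ M B → Decidable (Free board MakerWin M B)
    free? M B x = x ∈? board ×-dec ¬? (x ∈? M) ×-dec ¬? (x ∈? B)

    freeCount : List X → List X → ℕ
    freeCount M B = length (filter (free? M B) board)

    freeCount-decreasing : ∀ {M B e f k} → Free board MakerWin M B e → freeCount M B ≤ suc k →
                           freeCount (e ∷ M) (f ∷ B) ≤ k
    freeCount-decreasing {M} {B} {e} {f} e-free@(e∈board , _) bound = ≤-pred (≤-trans
      (length-filter-strict (free? M B) (free? (e ∷ M) (f ∷ B))
         (λ (x∈board , x∉eM , x∉fB) → x∈board , x∉eM ∘ there , x∉fB ∘ there)
         board e∈board e-free (λ (_ , e∉eM , _) → e∉eM (here refl)))
      bound)

    allClaimed : ∀ {M B} → ¬ Any (Free board MakerWin M B) board → AllClaimed board MakerWin M B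
    allClaimed {M} {B} no-free x x∈board with x ∈? M | x ∈? B
    ... | yes x∈M | _       = inj₁ x∈M
    ... | no _    | yes x∈B = inj₂ x∈B
    ... | no x∉M  | no x∉B  = contradiction (lose x∈board (x∈board , x∉M , x∉B)) no-free

    partners-claimed : ∀ {M B e} → Invariant M B → Free board MakerWin M B e →
                       ¬ Any (λ c → Paired e c × Free board MakerWin (e ∷ M) B c) board →
                       ∀ {c} → Paired e c → c ∈ B
    partners-claimed {M} {B} inv (_ , _ , e∉B) no-free-partner {c} e~c with c ∈? B | c ∈? M
    ... | yes c∈B | _       = c∈B
    ... | no _    | yes c∈M = contradiction (Invariant.answered inv (Paired-sym e~c) c∈M) e∉B
    ... | no c∉B  | no c∉M  =
      contradiction (lose (partner∈board e~c) (e~c , partner∈board e~c , c∉eM , c∉B)) no-free-partner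
      where
      c∉eM : c ∉ _ ∷ M
      c∉eM (here refl) = Paired-irrefl e~c
      c∉eM (there c∈M) = c∉M c∈M

    ¬win : ∀ {M B} → Invariant M B → ¬ MakerWin M
    ¬win inv = pairFree⇒¬win (Invariant.on-board inv) (pairFree inv)

    mutual
      makerToMove : ∀ k {M B} → Invariant M B → freeCount M B ≤ k → BreakerWinsM board MakerWin M B
      makerToMove k {M} {B} inv bound with any? (free? M B) board
      ... | yes some-free = moveM (_ , proj₂ (proj₂ (find some-free)))
                                  (λ _ e-free → breakerToMove k inv bound e-free)
      ... | no no-free    = endM (allClaimed no-free) (¬win inv)

      breakerToMove : ∀ k {M B e} → Invariant M B → freeCount M B ≤ k → Free board MakerWin M B e →
                      BreakerWinsB board MakerWin (e ∷ M) B
      breakerToMove zero {M} {B} inv bound e-free =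
        contradiction bound (<⇒≱ (filter-some (free? M B) (lose (proj₁ e-free) e-free)))
      breakerToMove (suc k) {M} {B} {e} inv bound e-free@(e∈board , e∉M , e∉B)
        with any? (λ c → Paired? e c ×-dec free? (e ∷ M) B c) board
      ... | yes free-partner with find free-partner
      ...   | b , _ , e~b , b-free@(_ , b∉eM , _) =
        moveB b b-free (makerToMove k inv′ (freeCount-decreasing e-free bound))
        where
        e∉bB : e ∉ b ∷ B
        e∉bB (here e≡b)  = b∉eM (here (sym e≡b))
        e∉bB (there e∈B) = e∉B e∈B
        inv′ : Invariant (e ∷ M) (b ∷ B)
        inv′ = claimByMaker (claimByBreaker inv (b∉eM ∘ there)) (e∈board , e∉M , e∉bB)
                            (λ e~c → here (Paired-functional e~c e~b))
      breakerToMove (suc k) {M} {B} {e} inv bound e-free | no no-free-partner =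
        claimAnyFree k inv′ (freeCount-decreasing e-free bound)
        where
        inv′ : Invariant (e ∷ M) B
        inv′ = claimByMaker inv e-free (partners-claimed inv e-free no-free-partner)

      claimAnyFree : ∀ k {M B} → Invariant M B → (∀ {f} → freeCount M (f ∷ B) ≤ k) →
                     BreakerWinsB board MakerWin M B
      claimAnyFree k {M} {B} inv bound with any? (free? M B) board
      ... | yes some-free with find some-free
      ...   | f , _ , f-free@(_ , f∉M , _) = moveB f f-free (makerToMove k (claimByBreaker inv f∉M) bound)
      claimAnyFree k inv bound | no no-free = endB (allClaimed no-free) (¬win inv)

    breakerWins : BreakerHasWinningStrategy board MakerWin
    breakerWins = makerToMove _ initial ≤-refl

_≟E_ : ∀ {n} → DecidableEquality (Edge n)
_≟E_ = ≡-dec Fin._≟_ Fin._≟_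

module _ {n : ℕ} (G : Graph n) where

  open Graph G
  open DecMembership (_≟E_ {n}) using () renaming (_∈?_ to _∈E?_)
  open DecMembership (Fin._≟_ {n}) using (_∈?_)

  Adj? : ∀ u w → Dec (Adj G u w)
  Adj? u w = ((u , w) ∈E? edges) ⊎-dec ((w , u) ∈E? edges)

  Adj-sym : ∀ {u w} → Adj G u w → Adj G w u
  Adj-sym (inj₁ uw∈) = inj₂ uw∈
  Adj-sym (inj₂ wu∈) = inj₁ wu∈

  ordered∈ : ∀ {e} → e ∈ edges → toℕ (proj₁ e) < toℕ (proj₂ e)
  ordered∈ = All.lookup ordered

  Adj-irrefl : ∀ {u w} → Adj G u w → u ≢ w
  Adj-irrefl (inj₁ uw∈) refl = <-irrefl refl (ordered∈ uw∈)
  Adj-irrefl (inj₂ wu∈) refl = <-irrefl refl (ordered∈ wu∈)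

  Joins : Edge n → Fin n → Fin n → Set
  Joins e u w = (e ≡ (u , w)) ⊎ (e ≡ (w , u))

  Adj⇒edge : ∀ {u w} → Adj G u w → ∃[ e ] e ∈ edges × Joins e u w
  Adj⇒edge (inj₁ uw∈) = _ , uw∈ , inj₁ refl
  Adj⇒edge (inj₂ wu∈) = _ , wu∈ , inj₂ refl

  Joins⇒Incident : ∀ {e u w} → Joins e u w → Incident G u e
  Joins⇒Incident (inj₁ refl) = inj₁ refl
  Joins⇒Incident (inj₂ refl) = inj₂ refl

  Incident⇒Adj : ∀ {e u} → e ∈ edges → Incident G u e → ∃[ w ] Adj G u w × Joins e u w
  Incident⇒Adj {a , b} e∈ (inj₁ refl) = b , inj₁ e∈ , inj₁ refl
  Incident⇒Adj {a , b} e∈ (inj₂ refl) = a , inj₂ e∈ , inj₂ refl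

  Joins-unique : ∀ {e e′ u w} → e ∈ edges → e′ ∈ edges →
                 Joins e u w → Joins e′ u w → e ≡ e′
  Joins-unique _  _   (inj₁ refl) (inj₁ refl) = refl
  Joins-unique _  _   (inj₂ refl) (inj₂ refl) = refl
  Joins-unique e∈ e′∈ (inj₁ refl) (inj₂ refl) =
    contradiction (ordered∈ e∈) (<-asym (ordered∈ e′∈))
  Joins-unique e∈ e′∈ (inj₂ refl) (inj₁ refl) =
    contradiction (ordered∈ e∈) (<-asym (ordered∈ e′∈))

  other-endpoint-unique : ∀ {e c v w} → Incident G c e → Incident G v e → Incident G w e →
                          c ≢ v → c ≢ w → v ≡ w
  other-endpoint-unique {a , b} (inj₁ refl) (inj₁ refl) _           c≢v _   = contradiction refl c≢v
  other-endpoint-unique {a , b} (inj₁ refl) _           (inj₁ refl) _   c≢w = contradiction refl c≢w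
  other-endpoint-unique {a , b} (inj₁ refl) (inj₂ refl) (inj₂ refl) _   _   = refl
  other-endpoint-unique {a , b} (inj₂ refl) (inj₂ refl) _           c≢v _   = contradiction refl c≢v
  other-endpoint-unique {a , b} (inj₂ refl) _           (inj₂ refl) _   c≢w = contradiction refl c≢w
  other-endpoint-unique {a , b} (inj₂ refl) (inj₁ refl) (inj₁ refl) _   _   = refl

  Chain-++⁻ˡ : ∀ xs {ys} → Chain G (xs ++ ys) → Chain G xs
  Chain-++⁻ˡ []           _             = tt
  Chain-++⁻ˡ (x ∷ [])     _             = tt
  Chain-++⁻ˡ (x ∷ y ∷ xs) (x~y , chain) = x~y , Chain-++⁻ˡ (y ∷ xs) chain

  Chain-∷ʳ : ∀ xs {a b} → Chain G (xs ++ [ a ]) → Adj G a b → Chain G (xs ++ a ∷ b ∷ [])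
  Chain-∷ʳ []           _             a~b = a~b , tt
  Chain-∷ʳ (x ∷ [])     (x~a , _)     a~b = x~a , a~b , tt
  Chain-∷ʳ (x ∷ y ∷ xs) (x~y , chain) a~b = x~y , Chain-∷ʳ (y ∷ xs) chain a~b

  back-edge⇒cycle : ∀ {h p t w} → Unique (h ∷ p ∷ t) → Chain G (h ∷ p ∷ t) →
                    Adj G h w → w ∈ t → HasCycle G
  back-edge⇒cycle {h} {p} {t} {w} unique chain h~w w∈t with ∈-∃++ w∈t
  ... | pre , post , refl =
    h , p ∷ pre ++ [ w ] , 2≤length
      , Unique-++⁻ˡ (h ∷ p ∷ pre ++ [ w ]) (subst Unique split unique)
      , subst (Chain G) close
          (Chain-∷ʳ (h ∷ p ∷ pre)
             (Chain-++⁻ˡ (h ∷ p ∷ pre ++ [ w ]) (subst (Chain G) split chain)) (Adj-sym h~w))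
    where
    2≤length : 2 ≤ length (p ∷ pre ++ [ w ])
    2≤length = s≤s (subst (1 ≤_) (sym (length-++ pre)) (m≤n+m 1 (length pre)))
    split : h ∷ p ∷ pre ++ [ w ] ++ post ≡ (h ∷ p ∷ pre ++ [ w ]) ++ post
    split = cong (λ xs → h ∷ p ∷ xs) (sym (++-assoc pre [ w ] post))
    close : (h ∷ p ∷ pre) ++ w ∷ h ∷ [] ≡ h ∷ (p ∷ pre ++ [ w ]) ++ [ h ]
    close = cong (λ xs → h ∷ p ∷ xs) (sym (++-assoc pre [ w ] [ h ]))

  Isolated : Fin n → Set
  Isolated r = ∀ u → ¬ Adj G r u

  record MaximalPath (r : Fin n) : Set where
    field
      tip next : Fin n
      rest     : List (Fin n)
      unique   : Unique (tip ∷ next ∷ rest)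
      chain    : Chain G (tip ∷ next ∷ rest)
      tip≢r    : tip ≢ r
      maximal  : ∀ {u} → Adj G tip u → u ∈ tip ∷ next ∷ rest

  -- r lies on the path or has no neighbours, so the tip is never moved to r.
  extendPath : ∀ {r} k h p t → n ≤ k + length (h ∷ p ∷ t) →
               Unique (h ∷ p ∷ t) → Chain G (h ∷ p ∷ t) → h ≢ r →
               (r ∈ h ∷ p ∷ t) ⊎ Isolated r → MaximalPath r
  extendPath {r} k h p t bound unique chain h≢r r-covered
    with Fin.any? (λ w → Adj? h w ×-dec ¬? (w ∈? (h ∷ p ∷ t)))
  ... | no cannot-extend = record
    { tip = h ; next = p ; rest = t ; unique = unique ; chain = chain ; tip≢r = h≢r ; maximal = maximal }
    where
    maximal : ∀ {u} → Adj G h u → u ∈ h ∷ p ∷ t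
    maximal {u} h~u with u ∈? (h ∷ p ∷ t)
    ... | yes u∈path = u∈path
    ... | no u∉path  = contradiction (u , h~u , u∉path) cannot-extend
  ... | yes (w , h~w , w∉path) with k
  ...   | zero  = contradiction (Unique-Fin⇒length≤ unique′) (<⇒≱ (s≤s bound))
    where
    unique′ : Unique (w ∷ h ∷ p ∷ t)
    unique′ = All.¬Any⇒All¬ _ w∉path ∷ unique
  ...   | suc k = extendPath k w h (p ∷ t) (subst (n ≤_) (sym (+-suc k _)) bound)
                    (All.¬Any⇒All¬ _ w∉path ∷ unique) (Adj-sym h~w , chain) w≢r
                    (map₁ there r-covered)
    where
    w≢r : w ≢ r
    w≢r = off-path r-covered
      where
      off-path : (r ∈ h ∷ p ∷ t) ⊎ Isolated r → w ≢ r
      off-path (inj₁ r∈path) refl = w∉path r∈path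
      off-path (inj₂ r-alone) refl = r-alone h (Adj-sym h~w)

  record Leaf (r : Fin n) : Set where
    field
      leaf           : Fin n
      pendant        : Edge n
      pendant∈       : pendant ∈ edges
      leaf-incident  : Incident G leaf pendant
      leaf≢r         : leaf ≢ r
      pendant-unique : ∀ {e} → e ∈ edges → Incident G leaf e → e ≡ pendant

  maximalPath⇒Leaf : ∀ {r} → Acyclic G → MaximalPath r → Leaf r
  maximalPath⇒Leaf {r} acyclic path = leafAt (Adj⇒edge (proj₁ chain))
    where
    open MaximalPath path

    only-neighbour : ∀ {u} → Adj G tip u → u ≡ next
    only-neighbour tip~u with maximal tip~u
    ... | here refl            = contradiction refl (Adj-irrefl tip~u)
    ... | there (here refl)    = refl
    ... | there (there u∈rest) = contradiction (back-edge⇒cycle unique chain tip~u u∈rest) acyclic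

    leafAt : ∃[ e ] e ∈ edges × Joins e tip next → Leaf r
    leafAt (e₀ , e₀∈ , e₀-joins) = record
      { leaf = tip ; pendant = e₀ ; pendant∈ = e₀∈ ; leaf-incident = Joins⇒Incident e₀-joins
      ; leaf≢r = tip≢r ; pendant-unique = pendant-unique }
      where
      pendant-unique : ∀ {e} → e ∈ edges → Incident G tip e → e ≡ e₀
      pendant-unique e∈ tip∈e with Incident⇒Adj e∈ tip∈e
      ... | _ , tip~w , joins =
        Joins-unique e∈ e₀∈ (subst (Joins _ tip) (only-neighbour tip~w) joins) e₀-joins

  acyclic⇒Leaf : Acyclic G → ∀ {e₁} → e₁ ∈ edges → (r : Fin n) → Leaf r
  acyclic⇒Leaf acyclic {a , b} e₁∈ r = maximalPath⇒Leaf acyclic (startPath (Fin.any? (Adj? r)))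
    where
    startPath : Dec (∃ (Adj G r)) → MaximalPath r
    startPath (yes (w , r~w)) =
      extendPath n w r [] (m≤m+n n 2) ((Adj-irrefl w~r ∷ []) ∷ [] ∷ []) (w~r , tt)
                 (Adj-irrefl w~r) (inj₁ (there (here refl)))
      where
      w~r : Adj G w r
      w~r = Adj-sym r~w
    startPath (no r-alone) =
      extendPath n b a [] (m≤m+n n 2) ((Adj-irrefl b~a ∷ []) ∷ [] ∷ []) (b~a , tt)
                 b≢r (inj₂ λ u r~u → r-alone (u , r~u))
      where
      b~a : Adj G b a
      b~a = inj₂ e₁∈
      b≢r : b ≢ r
      b≢r refl = r-alone (a , b~a)

record Orientation {n} (G : Graph n) : Set where
  field
    child           : Edge n → Fin n
    child-incident  : ∀ e → Incident G (child e) e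
    child-injective : ∀ {e e′} → e ∈ Graph.edges G → e′ ∈ Graph.edges G →
                      child e ≡ child e′ → e ≡ e′

Avoiding : ∀ {n} {G : Graph n} → Orientation G → Pred (Fin n) 0ℓ → Set
Avoiding {G = G} O P = ∀ {e} → e ∈ Graph.edges G → ¬ P (Orientation.child O e)

_∖_ : ∀ {n} → Graph n → Edge n → Graph n
G ∖ e₀ = record
  { edges    = filter (¬? ∘ (_≟E e₀)) (Graph.edges G)
  ; ordered  = All.filter⁺ (¬? ∘ (_≟E e₀)) (Graph.ordered G)
  ; distinct = Unique.filter⁺ (¬? ∘ (_≟E e₀)) (Graph.distinct G)
  }

length-∖ : ∀ {n} (G : Graph n) {e₀} → e₀ ∈ Graph.edges G →
           length (Graph.edges (G ∖ e₀)) < length (Graph.edges G)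
length-∖ G e₀∈ =
  filter-notAll (¬? ∘ (_≟E _)) (Graph.edges G)
                (Any.map (λ e₀≡e e≢e₀ → e≢e₀ (sym e₀≡e)) e₀∈)

Acyclic-mono : ∀ {n} {G H : Graph n} → Graph.edges H ⊆ Graph.edges G → Acyclic G → Acyclic H
Acyclic-mono {G = G} {H} H⊆G acyclic (v , ws , long , unique , chain) =
  acyclic (v , ws , long , unique , Chain-mono _ chain)
  where
  Chain-mono : ∀ xs → Chain H xs → Chain G xs
  Chain-mono []           _                    = tt
  Chain-mono (x ∷ [])     _                    = tt
  Chain-mono (x ∷ y ∷ xs) (inj₁ xy∈ , chain) = inj₁ (H⊆G xy∈) , Chain-mono (y ∷ xs) chain
  Chain-mono (x ∷ y ∷ xs) (inj₂ yx∈ , chain) = inj₂ (H⊆G yx∈) , Chain-mono (y ∷ xs) chain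

RootedOrientation : ∀ {n} → Graph n → Fin n → Set
RootedOrientation G r = Σ[ O ∈ Orientation G ] Avoiding O (_≡ r)

edgeless-orientation : ∀ {n} (G : Graph n) → (∀ {e} → e ∉ Graph.edges G) → ∀ r →
                       RootedOrientation G r
edgeless-orientation G no-edges r = record
  { child           = proj₁
  ; child-incident  = λ _ → inj₁ refl
  ; child-injective = λ e∈ → contradiction e∈ no-edges }
  , λ e∈ → contradiction e∈ no-edges

module _ {n} (G : Graph n) {r} (L : Leaf G r) where

  open Leaf L

  extendOrientation : RootedOrientation (G ∖ pendant) r → RootedOrientation G r
  extendOrientation (O , avoids-r) = O′ , avoids-r′
    where
    module O = Orientation O

    remaining : ∀ {e} → e ∈ Graph.edges G → e ≢ pendant → e ∈ Graph.edges (G ∖ pendant)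
    remaining = ∈-filter⁺ (¬? ∘ (_≟E pendant))

    child′ : Edge n → Fin n
    child′ e with e ≟E pendant
    ... | yes _ = leaf
    ... | no _  = O.child e

    child′-incident : ∀ e → Incident G (child′ e) e
    child′-incident e with e ≟E pendant
    ... | yes refl = leaf-incident
    ... | no _     = O.child-incident e

    child-is-pendant : ∀ {e} → e ∈ Graph.edges G → O.child e ≡ leaf → e ≡ pendant
    child-is-pendant {e} e∈ child≡leaf =
      pendant-unique e∈ (subst (λ v → Incident G v e) child≡leaf (O.child-incident e))

    child′-injective : ∀ {e e′} → e ∈ Graph.edges G → e′ ∈ Graph.edges G →
                       child′ e ≡ child′ e′ → e ≡ e′
    child′-injective {e} {e′} e∈ e′∈ same with e ≟E pendant | e′ ≟E pendant
    ... | yes refl | yes refl = refl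
    ... | yes refl | no e′≢p  = contradiction (child-is-pendant e′∈ (sym same)) e′≢p
    ... | no e≢p   | yes refl = contradiction (child-is-pendant e∈ same) e≢p
    ... | no e≢p   | no e′≢p  = O.child-injective (remaining e∈ e≢p) (remaining e′∈ e′≢p) same

    O′ : Orientation G
    O′ = record
      { child = child′ ; child-incident = child′-incident ; child-injective = child′-injective }

    avoids-r′ : Avoiding O′ (_≡ r)
    avoids-r′ {e} e∈ with e ≟E pendant
    ... | yes _   = leaf≢r
    ... | no e≢p  = avoids-r (remaining e∈ e≢p)

rootedOrientation : ∀ {n} k (G : Graph n) → length (Graph.edges G) ≤ k → Acyclic G → ∀ r →
                    RootedOrientation G r
rootedOrientation k G bound acyclic r with empty-or-member (Graph.edges G)
... | inj₁ no-edges = edgeless-orientation G no-edges r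
... | inj₂ (e₁ , e₁∈) with k
...   | zero  = contradiction (<-≤-trans (length-∖ G e₁∈) bound) n≮0
...   | suc k = extendOrientation G L
                  (rootedOrientation k (G ∖ pendant) shorter
                     (Acyclic-mono (proj₁ ∘ ∈-filter⁻ _) acyclic) r)
  where
  L : Leaf G r
  L = acyclic⇒Leaf G acyclic e₁∈ r
  open Leaf L
  shorter : length (Graph.edges (G ∖ pendant)) ≤ k
  shorter = ≤-pred (<-≤-trans (length-∖ G pendant∈) bound)

acyclic⇒orientation-avoiding : ∀ {n} (G : Graph n) → Acyclic G →
                               {P : Pred (Fin n) 0ℓ} → Decidable P →
                               (∀ {u v} → P u → P v → u ≡ v) →
                               Σ[ O ∈ Orientation G ] Avoiding O P
acyclic⇒orientation-avoiding {zero} G _ _ _ =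
  record { child = proj₁ ; child-incident = λ _ → inj₁ refl ; child-injective = λ { {() , _} } }
  , λ { {() , _} }
acyclic⇒orientation-avoiding {suc n} G acyclic P? P-unique with Fin.any? P?
... | yes (r , Pr) = let O , avoids-r = rootedOrientation _ G ≤-refl acyclic r
                     in O , λ e∈ Pchild → avoids-r e∈ (P-unique Pchild Pr)
... | no no-P      = proj₁ (rootedOrientation _ G ≤-refl acyclic Fin.zero)
                   , λ _ Pchild → no-P (_ , Pchild)

module StarGame {n} (T : Graph n) (m : ℕ) (O : Orientation T)
                (degree≤ : ∀ v → degree T v ≤ 2 * m)
                (child-not-full : Avoiding O (λ v → degree T v ≡ 2 * m)) where

  open Graph T
  open Orientation O
  open Positions (_≟E_ {n})
  open PairingStrategy (_≟E_ {n}) edges (HasStar T (suc m))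

  -- the decision procedure inside degree, so that degree-split is an instance of length-filter-split
  incident? : ∀ v → Decidable (Incident T v)
  incident? v e = (proj₁ e Fin.≟ v) ⊎-dec (proj₂ e Fin.≟ v)

  childIs? : ∀ v → Decidable (λ e → child e ≡ v)
  childIs? v e = child e Fin.≟ v

  childEdge? : ∀ v → Decidable (λ e → Incident T v e × child e ≢ v)
  childEdge? v e = incident? v e ×-dec ¬? (childIs? v e)

  parentEdges childEdges : Fin n → List (Edge n)
  parentEdges v = filter (childIs? v) edges
  childEdges  v = filter (childEdge? v) edges

  degree-split : ∀ v → degree T v ≡ length (parentEdges v) + length (childEdges v)
  degree-split v = length-filter-split (childIs? v) (incident? v)
    (λ {e} child≡v → subst (λ u → Incident T u e) child≡v (child-incident e)) edges

  parentEdges≤1 : ∀ v → length (parentEdges v) ≤ 1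
  parentEdges≤1 v = length-filter≤1 (childIs? v) distinct
    (λ a∈ b∈ child-a≡v child-b≡v → child-injective a∈ b∈ (trans child-a≡v (sym child-b≡v)))

  parent⇒not-full : ∀ {v} → 0 < length (parentEdges v) → degree T v ≢ 2 * m
  parent⇒not-full {v} has-parent with find (filter-nonempty (childIs? v) edges has-parent)
  ... | e , e∈ , refl = child-not-full e∈

  ∈childEdges⁻ : ∀ {v e} → e ∈ childEdges v → e ∈ edges × Incident T v e × child e ≢ v
  ∈childEdges⁻ {v} = ∈-filter⁻ (childEdge? v)

  childEdges-disjoint : ∀ {v w e} → e ∈ childEdges v → e ∈ childEdges w → v ≡ w
  childEdges-disjoint {e = e} e∈v e∈w with ∈childEdges⁻ e∈v | ∈childEdges⁻ e∈w
  ... | _ , v∈e , child≢v | _ , w∈e , child≢w =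
    other-endpoint-unique T (child-incident e) v∈e w∈e child≢v child≢w

  Paired : Edge n → Edge n → Set
  Paired a b = ∃[ v ] PairedIn (childEdges v) a b

  pairing : Pairing
  pairing = record
    { Paired            = Paired
    ; Paired?           = λ a b → Fin.any? (λ v → PairedIn? (childEdges v) a b)
    ; Paired-sym        = λ (v , a~b) → v , PairedIn-sym a~b
    ; Paired-functional = functional
    ; Paired-irrefl     = λ (_ , _ , _ , a≢a , _) → a≢a refl
    ; partner∈board     = λ (_ , _ , b∈ , _) → proj₁ (∈childEdges⁻ b∈)
    }
    where
    functional : ∀ {a b c} → Paired a b → Paired a c → b ≡ c
    functional (v , a~b@(a∈v , _)) (w , a~c@(a∈w , _)) with childEdges-disjoint {v} {w} a∈v a∈w
    ... | refl = PairedIn-functional a~b a~c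

  -- The parent edge of v gets slot 0, the child edges at positions 2i and 2i + 1 share the slot
  -- (number of parent edges) + i; so a pair-free Maker set occupies pairwise distinct slots at v.
  slot : Fin n → Edge n → ℕ
  slot v e with childIs? v e
  ... | yes _ = 0
  ... | no _  = length (parentEdges v) + ⌊ position (childEdges v) e /2⌋

  slot-arith : ∀ {h o k} → h ≤ 1 → h + o ≤ 2 * m → (0 < h → h + o ≢ 2 * m) → k < o →
               h + ⌊ k /2⌋ < m
  slot-arith {zero}     _ o≤2m   _        k<o = ⌊/2⌋-< (≤-trans k<o o≤2m)
  slot-arith {suc zero} _ 1+o≤2m not-full k<o =
    ⌊/2⌋-< (≤-trans (s≤s (s≤s k<o)) (≤∧≢⇒< 1+o≤2m (not-full z<s)))
  slot-arith {suc (suc _)} (s≤s ()) _ _ _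

  slot< : ∀ {v e} → e ∈ edges → Incident T v e → slot v e < m
  slot< {v} {e} e∈ v∈e with childIs? v e
  ... | yes child≡v =
    *-cancelˡ-< 2 0 m (≤-<-trans z≤n (≤∧≢⇒< (degree≤ v) (parent⇒not-full has-parent)))
    where
    has-parent : 0 < length (parentEdges v)
    has-parent = filter-some (childIs? v) (lose e∈ child≡v)
  ... | no child≢v  = slot-arith (parentEdges≤1 v) (subst (_≤ 2 * m) (degree-split v) (degree≤ v))
                        (λ has-parent → parent⇒not-full has-parent ∘ trans (degree-split v))
                        (position< (∈-filter⁺ (childEdge? v) e∈ (v∈e , child≢v)))

  slot-injective : ∀ {M} → M ⊆ edges → PairFree pairing M → ∀ {v a b} →
                   a ∈ M → Incident T v a → b ∈ M → Incident T v b → a ≢ b →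
                   slot v a ≢ slot v b
  slot-injective M⊆edges pair-free {v} {a} {b} a∈M v∈a b∈M v∈b a≢b with childIs? v a | childIs? v b
  ... | yes child-a≡v | yes child-b≡v =
    λ _ → a≢b (child-injective (M⊆edges a∈M) (M⊆edges b∈M) (trans child-a≡v (sym child-b≡v)))
  ... | yes child-a≡v | no _ =
    λ 0≡slot → <⇒≢ (filter-some (childIs? v) (lose (M⊆edges a∈M) child-a≡v))
                   (sym (m+n≡0⇒m≡0 _ (sym 0≡slot)))
  ... | no _ | yes child-b≡v =
    λ slot≡0 → <⇒≢ (filter-some (childIs? v) (lose (M⊆edges b∈M) child-b≡v))
                   (sym (m+n≡0⇒m≡0 _ slot≡0))
  ... | no child-a≢v | no child-b≢v =
    λ same → pair-free (v , ∈-filter⁺ (childEdge? v) (M⊆edges a∈M) (v∈a , child-a≢v)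
                          , ∈-filter⁺ (childEdge? v) (M⊆edges b∈M) (v∈b , child-b≢v)
                          , a≢b , +-cancelˡ-≡ _ _ _ same) a∈M b∈M

  pairFree⇒¬star : ∀ {M} → M ⊆ edges → PairFree pairing M → ¬ HasStar T (suc m) M
  pairFree⇒¬star {M} M⊆edges pair-free (v , S , length≡ , unique , S⊆M , S-at-v) =
    contradiction (subst (_≤ m) (trans (length-map (slot v) S) length≡) slots≤m) 1+n≰n
    where
    at-v : All (λ e → e ∈ M × Incident T v e) S
    at-v = All.zip (S⊆M , S-at-v)
    slots≤m : length (map (slot v) S) ≤ m
    slots≤m = Unique-<⇒length≤ m
      (Unique-map⁺-on (slot v)
         (λ (a∈M , v∈a) (b∈M , v∈b) → slot-injective M⊆edges pair-free a∈M v∈a b∈M v∈b)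
         at-v unique)
      (All.map⁺ (All.map (λ (e∈M , v∈e) → slot< (M⊆edges e∈M) v∈e) at-v))

  breakerWins : BreakerWinsStarGame T (suc m)
  breakerWins = Strategy.breakerWins pairing pairFree⇒¬star

lemma14 : (ℓ : ℕ) → 1 ≤ ℓ → (n : ℕ) → (T : Graph n) → IsTree T →
          (∀ v → degree T v ≤ 2 * ℓ ∸ 2) →
          (∀ u v → degree T u ≡ 2 * ℓ ∸ 2 → degree T v ≡ 2 * ℓ ∸ 2 → u ≡ v) →
          BreakerWinsStarGame T ℓ
lemma14 (suc m) _ n T (_ , acyclic) degree≤ full-unique
  with acyclic⇒orientation-avoiding T acyclic (λ v → degree T v ≟ 2 * suc m ∸ 2) (full-unique _ _)
... | O , avoids-full =
  StarGame.breakerWins T m O (λ v → subst (degree T v ≤_) 2ℓ∸2≡2m (degree≤ v))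
                             (λ e∈ full → avoids-full e∈ (trans full (sym 2ℓ∸2≡2m)))
  where
  2ℓ∸2≡2m : 2 * suc m ∸ 2 ≡ 2 * m
  2ℓ∸2≡2m = sym (*-distribˡ-∸ 2 (suc m) 1)
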